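{- For $n\ge 1$, $a_n(12;1\to 2)=B_n$, the $n$-th Bell number.
   Context: Standard cycle form of $\sigma\in S_n$: product of disjoint cycles (fixed points included), each cycle starting with its largest element, cycles listed in increasing order of largest elements. The fundamental bijection $\theta:S_n\to S_n$ erases the parentheses of the standard cycle form to give a one-line permutation. For $\pi\in S_n$, $\hat\pi=\theta^{ -1}(\pi)$. An arrow pattern $(\nu;H)$ of size $k$: a string $\nu=a_1\dots a_m$ of positive integers and a set $H$ of arrows $b\to c$, with all integers appearing forming $[k]$. $\pi\in S_n$ contains $(\nu;H)$ if there is $X=\{x_1<\dots<x_k\}\subseteq[n]$ with positions $t_1<\dots<t_m$ such that $\pi_{t_1}\cdots\pi_{t_m}=x_{a_1}\cdots x_{a_m}$ and $\hat\pi(x_b)=x_c$ for every arrow $b\to c\in H$; otherwise it avoids it. $a_n(\nu;H)$ = number of $\pi\in S_n$ avoiding $(\nu;H)$. $B_n$ is the number of set partitions of $[n]$. -}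

module Defs where

open import Data.Nat using (ℕ; zero; suc; _+_; _*_)
open import Data.Fin using (Fin; zero; suc; toℕ) renaming (_<_ to _<ᶠ_; _≤_ to _≤ᶠ_)
open import Data.Vec using (Vec; lookup; toList; []; _∷_)
open import Data.List using (List; []; _∷_; concatMap; allFin)
open import Data.List.Relation.Unary.All using (All)
open import Data.List.Relation.Unary.Linked using (Linked)
open import Data.List.Relation.Binary.Permutation.Propositional using (_↭_)
open import Data.Product using (Σ; ∃; _×_; _,_; proj₁)
open import Relation.Binary.PropositionalEquality using (_≡_)
open import Relation.Nullary using (¬_)

-- Permutations of [n] (0-indexed as Fin n), in one-line notation.
-- A vector w represents the map i ↦ lookup w i.

IsPerm : ∀ {n} → Vec (Fin n) n → Set
IsPerm {n} w = ∀ (i j : Fin n) → lookup w i ≡ lookup w j → i ≡ j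

-- Standard cycle form.
-- A cycle is written as a head x followed by a list xs; the cycle
-- (x xs₁ … xsₘ) of σ means σ x = xs₁, σ xs₁ = xs₂, …, σ xsₘ = x.

Path : ∀ {n} → Vec (Fin n) n → Fin n → List (Fin n) → Fin n → Set
Path σ x []       h = lookup σ x ≡ h
Path σ x (y ∷ ys) h = (lookup σ x ≡ y) × Path σ y ys h

Cycle : ℕ → Set
Cycle n = Fin n × List (Fin n)

cycleList : ∀ {n} → Cycle n → List (Fin n)
cycleList (x , xs) = x ∷ xs

IsStdCycle : ∀ {n} → Vec (Fin n) n → Cycle n → Set
IsStdCycle σ (x , xs) = Path σ x xs x × All (λ y → y ≤ᶠ x) xs

flatten : ∀ {n} → List (Cycle n) → List (Fin n)
flatten = concatMap cycleList

StdCycleForm : ∀ {n} → Vec (Fin n) n → List (Cycle n) → Set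
StdCycleForm {n} σ cs =
  All (IsStdCycle σ) cs ×
  Linked (λ c d → proj₁ c <ᶠ proj₁ d) cs ×
  (flatten cs ↭ allFin n)

-- Θ σ π : θ(σ) = π, i.e. π is obtained by erasing the parentheses
-- of the standard cycle form of σ.
Θ : ∀ {n} → Vec (Fin n) n → Vec (Fin n) n → Set
Θ σ π = Σ (List (Cycle _)) λ cs → StdCycleForm σ cs × (flatten cs ≡ toList π)

-- Arrow patterns (ν ; H) of size k, letters 0-indexed (letter a ∈ Fin k
-- stands for the paper's a+1).  ν has length m.

record ArrowPattern : Set where
  field
    k : ℕ
    m : ℕ
    ν : Vec (Fin k) m
    H : List (Fin k × Fin k)

StrictlyIncreasing : ∀ {a b} → (Fin a → Fin b) → Set
StrictlyIncreasing {a} f = ∀ (i j : Fin a) → i <ᶠ j → f i <ᶠ f j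

-- Occurrence of the pattern in π, with σ playing the role of π̂.
Occurs : ∀ {n} → ArrowPattern → Vec (Fin n) n → Vec (Fin n) n → Set
Occurs {n} P π σ =
  Σ (Fin k → Fin n) λ x → StrictlyIncreasing x ×
  Σ (Fin m → Fin n) λ t → StrictlyIncreasing t ×
  (∀ (j : Fin m) → lookup π (t j) ≡ x (lookup ν j)) ×
  All (λ bc → lookup σ (x (Data.Product.proj₁ bc)) ≡ x (Data.Product.proj₂ bc)) H
  where open ArrowPattern P

Contains : ∀ {n} → ArrowPattern → Vec (Fin n) n → Set
Contains {n} P π = Σ (Vec (Fin n) n) λ σ → IsPerm σ × Θ σ π × Occurs P π σ

Avoids : ∀ {n} → ArrowPattern → Vec (Fin n) n → Set
Avoids P π = ¬ Contains P π

pat12 : ArrowPattern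
pat12 = record { k = 2 ; m = 2 ; ν = zero ∷ suc zero ∷ [] ; H = (zero , suc zero) ∷ [] }

-- Counting: "exactly N permutations of [n] avoid P" means there is an
-- injective listing Fin N → S_n whose image is exactly the avoiders.

HasExactlyAvoiders : ℕ → ArrowPattern → ℕ → Set
HasExactlyAvoiders n P N =
  Σ (Fin N → Vec (Fin n) n) λ f →
    (∀ i j → f i ≡ f j → i ≡ j) ×
    (∀ i → IsPerm (f i) × Avoids P (f i)) ×
    (∀ π → IsPerm π → Avoids P π → ∃ λ i → f i ≡ π)

-- Bell numbers via Stirling numbers of the second kind:
-- B_n = Σ_{j=0}^{n} S(n,j), S(n,j) = # partitions of [n] into j blocks.

stirling2 : ℕ → ℕ → ℕ
stirling2 zero    zero    = 1
stirling2 zero    (suc j) = 0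
stirling2 (suc n) zero    = 0
stirling2 (suc n) (suc j) = suc j * stirling2 n (suc j) + stirling2 n j

sumUpTo : (ℕ → ℕ) → ℕ → ℕ
sumUpTo f zero    = f zero
sumUpTo f (suc j) = sumUpTo f j + f (suc j)

Bell : ℕ → ℕ
Bell n = sumUpTo (stirling2 n) n

-- Write π̂ = θ⁻¹(π) in standard cycle form. An occurrence of (12 ; 1→2) is an ascent
-- x < π̂(x) with x to the left of π̂(x) in π. Consecutive entries of a cycle are
-- adjacent in π, while the step from the last entry back to the head goes to the left;
-- hence π avoids the pattern exactly when every cycle of π̂ decreases from its head.
-- Such cycle forms are the set partitions of [n] (blocks listed decreasingly, ordered by
-- their maxima). Removing the least element shows that there are S(n, j) of them with j
-- blocks, since it either forms a singleton block or ends one of the other blocks;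
-- summing over j gives B_n.

module Submission where

open import Defs
open import Data.Nat using (ℕ; _≤_)

open import Data.Nat using (zero; suc; _<_; z≤n; s≤s; s≤s⁻¹; s<s⁻¹)
open import Data.Nat.Properties
  using (≮⇒≥; <⇒≱; <⇒≤; ≤-reflexive; ≤-trans; n≤0⇒n≡0; m≤n⇒m≤1+n; m≤n⇒m<n∨m≡n)
import Data.Nat.Properties as ℕₚ
open import Data.Fin using (Fin; zero; suc; toℕ; fromℕ<; punchOut) renaming (_<_ to _<ᶠ_; _≤_ to _≤ᶠ_)
open import Data.Fin.Properties
  using (0≢1+n; _≟_; _<?_; <-cmp; <-asym; punchOut-injective; injective⇒≤;
         toℕ<n; toℕ-fromℕ<; toℕ-injective; +↔⊎; *↔×)
import Data.Fin.Properties as Finₚ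
open import Data.Vec using (Vec; []; _∷_; lookup; tabulate; toList; fromList; cast)
open import Data.Vec.Properties using (lookup∘tabulate; toList-cast; toList∘fromList; toList-injective; length-toList)
open import Data.Vec.Relation.Binary.Equality.Cast using (cast-is-id)
open import Data.Vec.Membership.Propositional.Properties using (∈-toList⁻; ∈-toList⁺; ∈-lookup)
open import Data.Vec.Relation.Unary.Any using (index)
open import Data.Vec.Relation.Unary.Any.Properties using (lookup-index)
open import Data.List using (List; []; _∷_; _++_; _∷ʳ_; [_]; map; concatMap; length; allFin)
open import Data.List.Properties
  using (∷-injective; ∷-injectiveˡ; ∷-injectiveʳ; ∷ʳ-injectiveˡ; map-injective; ++-assoc; map-++;
         concatMap-map; map-concatMap; concatMap-cong; length-map; length-++-≤ʳ; length-tabulate)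
open import Data.List.Relation.Unary.All as All using (All; []; _∷_)
import Data.List.Relation.Unary.All.Properties as Allₚ
open import Data.List.Relation.Unary.Any using (here; there; any?)
open import Data.List.Relation.Unary.Any.Properties using (¬Any[])
open import Data.List.Relation.Unary.Linked as Linked using (Linked; []; [-]; _∷_)
import Data.List.Relation.Unary.Linked.Properties as Linkedₚ
open import Data.List.Relation.Unary.Unique.Propositional using (Unique; []; _∷_)
import Data.List.Relation.Unary.Unique.Propositional.Properties as Uniqueₚ
open import Data.List.Membership.Propositional using (_∈_; _∉_)
open import Data.List.Membership.Propositional.Properties
  using (∈-map⁺; ∈-map⁻; ∈-++⁺ˡ; ∈-++⁺ʳ; ∈-++⁻; ∈-allFin)
open import Data.List.Membership.Propositional.Properties.WithK using (unique∧set⇒bag)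
open import Data.List.Relation.Binary.BagAndSetEquality using (∼bag⇒↭)
open import Data.List.Relation.Binary.Permutation.Propositional
  using (_↭_; ↭-sym; ↭-trans; ↭-reflexive; ↭-prep; ↭⇒↭ₛ; module PermutationReasoning)
import Data.List.Relation.Binary.Permutation.Propositional.Properties as ↭
import Data.List.Relation.Binary.Permutation.Setoid.Properties as ↭ₛ
open import Data.Product as Product using (Σ; ∃; ∃₂; _×_; _,_; proj₁; proj₂; map₁)
open import Data.Sum as Sum using (_⊎_; inj₁; inj₂; [_,_]′)
open import Data.Sum.Properties using (inj₁-injective; inj₂-injective)
open import Data.Empty using (⊥-elim)
open import Function using (id; _∘_; _↔_; Inverse; _⇔_; mk⇔; Equivalence)
open import Relation.Nullary using (¬_; yes; no)
open import Relation.Binary.Definitions using (DecidableEquality; tri<; tri≈; tri>)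
open import Relation.Binary.PropositionalEquality hiding ([_]; J)

private variable
  A B I J K : Set
  n : ℕ

-- Lists and vectors without repetitions

LookupInjective : Vec A n → Set
LookupInjective {n = n} v = ∀ (i j : Fin n) → lookup v i ≡ lookup v j → i ≡ j

lookupInjective⇒unique : (v : Vec A n) → LookupInjective v → Unique (toList v)
lookupInjective⇒unique []      _   = []
lookupInjective⇒unique (x ∷ v) inj =
  All.tabulate x∉v ∷ lookupInjective⇒unique v (λ i j → Finₚ.suc-injective ∘ inj (suc i) (suc j))
  where
  x∉v : ∀ {y} → y ∈ toList v → x ≢ y
  x∉v y∈v x≡y = let p = ∈-toList⁻ y∈v in 0≢1+n (inj zero (suc (index p)) (trans x≡y (lookup-index p)))

unique⇒lookupInjective : (v : Vec A n) → Unique (toList v) → LookupInjective v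
unique⇒lookupInjective (x ∷ v) _         zero    zero    _  = refl
unique⇒lookupInjective (x ∷ v) (x∉v ∷ _) zero    (suc j) eq =
  ⊥-elim (All.lookup x∉v (∈-toList⁺ (∈-lookup j v)) eq)
unique⇒lookupInjective (x ∷ v) (x∉v ∷ _) (suc i) zero    eq =
  ⊥-elim (All.lookup x∉v (∈-toList⁺ (∈-lookup i v)) (sym eq))
unique⇒lookupInjective (x ∷ v) (_ ∷ u)   (suc i) (suc j) eq = cong suc (unique⇒lookupInjective v u i j eq)

-- If y were missed, punching it out would inject Fin (suc m) into Fin m.
perm⇒∈ : (v : Vec (Fin n) n) → IsPerm v → ∀ y → y ∈ toList v
perm⇒∈ {n = suc m} v inj y with any? (y ≟_) (toList v)
... | yes y∈v = y∈v
... | no  y∉v = ⊥-elim (ℕₚ.<-irrefl refl (injective⇒≤ punchOut-injective′))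
  where
  y≢ : ∀ i → y ≢ lookup v i
  y≢ i eq = y∉v (subst (_∈ toList v) (sym eq) (∈-toList⁺ (∈-lookup i v)))
  punchOut-injective′ : ∀ {i j} → punchOut (y≢ i) ≡ punchOut (y≢ j) → i ≡ j
  punchOut-injective′ {i} {j} eq = inj i j (punchOut-injective (y≢ i) (y≢ j) eq)

vec-toList-injective : (xs ys : Vec A n) → toList xs ≡ toList ys → xs ≡ ys
vec-toList-injective xs ys eq = trans (sym (cast-is-id refl xs)) (toList-injective refl xs ys eq)

before⇒indices : ∀ (v : Vec A n) xs {a b ys} → toList v ≡ xs ++ a ∷ ys → b ∈ ys →
                 ∃₂ λ i j → i <ᶠ j × lookup v i ≡ a × lookup v j ≡ b
before⇒indices (x ∷ v) []       eq b∈ys with refl , refl ← ∷-injective eq =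
  let p = ∈-toList⁻ b∈ys in zero , suc (index p) , s≤s z≤n , refl , sym (lookup-index p)
before⇒indices (x ∷ v) (_ ∷ xs) eq b∈ys with refl , eq′ ← ∷-injective eq =
  let i , j , i<j , vi≡a , vj≡b = before⇒indices v xs eq′ b∈ys in suc i , suc j , s≤s i<j , vi≡a , vj≡b

Unique-resp-↭ : {xs ys : List A} → xs ↭ ys → Unique xs → Unique ys
Unique-resp-↭ {A = A} p = ↭ₛ.Unique-resp-↭ (setoid A) (↭⇒↭ₛ p)

unique-++ʳ : ∀ xs {ys : List A} → Unique (xs ++ ys) → Unique ys
unique-++ʳ []       u       = u
unique-++ʳ (_ ∷ xs) (_ ∷ u) = unique-++ʳ xs u

unique-disjoint : ∀ xs {ys : List A} {y} → Unique (xs ++ ys) → y ∈ ys → y ∉ xs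
unique-disjoint (_ ∷ xs) (x∉ ∷ _) y∈ys (here refl)  = All.lookup x∉ (∈-++⁺ʳ xs y∈ys) refl
unique-disjoint (_ ∷ xs) (_ ∷ u)  y∈ys (there y∈xs) = unique-disjoint xs u y∈ys y∈xs

unique-remove : ∀ xs {ys : List A} {y} → Unique (xs ++ y ∷ ys) → y ∉ xs ++ ys
unique-remove xs {ys} {y} u with y∉ ∷ _ ← Unique-resp-↭ (↭.shift y xs ys) u = λ y∈ → All.lookup y∉ y∈ refl

unique∧covers⇒↭allFin : {xs : List (Fin n)} → Unique xs → (∀ x → x ∈ xs) → xs ↭ allFin n
unique∧covers⇒↭allFin {n = n} u covers =
  ∼bag⇒↭ (unique∧set⇒bag u (Uniqueₚ.allFin⁺ n) (mk⇔ (λ _ → ∈-allFin _) (λ _ → covers _)))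

unique-extend : {xs : List (Fin n)} → Unique xs ⇔ Unique (zero ∷ map suc xs)
unique-extend {xs = xs} = mk⇔
  (λ u → Allₚ.map⁺ (All.universal (λ _ ()) xs) ∷ Uniqueₚ.map⁺ Finₚ.suc-injective u)
  (λ { (_ ∷ u) → Uniqueₚ.map⁻ u })

covers-extend : {xs : List (Fin n)} → (∀ x → x ∈ xs) ⇔ (∀ x → x ∈ zero ∷ map suc xs)
covers-extend {xs = xs} = mk⇔ to from
  where
  to : (∀ x → x ∈ xs) → ∀ x → x ∈ zero ∷ map suc xs
  to covers zero    = here refl
  to covers (suc x) = there (∈-map⁺ suc (covers x))
  from : (∀ x → x ∈ zero ∷ map suc xs) → ∀ x → x ∈ xs
  from covers x with there sx∈ ← covers (suc x) with y , y∈xs , sx≡sy ← ∈-map⁻ suc sx∈ =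
    subst (_∈ xs) (sym (Finₚ.suc-injective sx≡sy)) y∈xs

-- Finite enumerations

record Enumeration (I : Set) {A : Set} (P : A → Set) : Set where
  field
    enum      : I → A
    injective : ∀ {i j} → enum i ≡ enum j → i ≡ j
    sound     : ∀ i → P (enum i)
    complete  : ∀ {a} → P a → ∃ λ i → enum i ≡ a

open Enumeration

module _ {P : A → Set} where

  empty : (∀ {a} → ¬ P a) → Enumeration (Fin 0) P
  empty ¬P = record { enum = λ () ; injective = λ { {()} } ; sound = λ () ; complete = ⊥-elim ∘ ¬P }

  singleton : {a : A} → P a → (∀ {b} → P b → b ≡ a) → Enumeration (Fin 1) P
  singleton {a} Pa only = record
    { enum = λ _ → a ; injective = λ { {zero} {zero} _ → refl } ; sound = λ _ → Pa
    ; complete = λ Pb → zero , sym (only Pb) }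

  reindex : J ↔ I → Enumeration I P → Enumeration J P
  reindex J↔I E = record
    { enum      = enum E ∘ to
    ; injective = λ {i} {j} eq → trans (sym (strictlyInverseʳ i))
                                   (trans (cong from (injective E eq)) (strictlyInverseʳ j))
    ; sound     = sound E ∘ to
    ; complete  = λ Pa → let i , eq = complete E Pa in from i , trans (cong (enum E) (strictlyInverseˡ i)) eq
    }
    where open Inverse J↔I

  pairs : Enumeration I P → Enumeration (K × I) (P ∘ proj₂)
  pairs E = record
    { enum      = Product.map₂ (enum E)
    ; injective = λ eq → cong₂ _,_ (cong proj₁ eq) (injective E (cong proj₂ eq))
    ; sound     = sound E ∘ proj₂
    ; complete  = λ { {k , _} Pa → let i , eq = complete E Pa in (k , i) , cong (k ,_) eq }
    }

  -- The proof argument of g is irrelevant (usable only for typing, e.g. a length cast),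
  -- so g a p does not depend on which proof p of P a is chosen.
  image : {Q : B → Set} (g : ∀ a → .(P a) → B) →
          (∀ a a′ (p : P a) (p′ : P a′) → g a p ≡ g a′ p′ → a ≡ a′) →
          (∀ a (p : P a) → Q (g a p)) →
          (∀ {b} → Q b → ∃ λ a → Σ (P a) λ p → g a p ≡ b) →
          Enumeration I P → Enumeration I Q
  image g g-injective g-sound g-complete E = record
    { enum      = λ i → g (enum E i) (sound E i)
    ; injective = λ {i} {j} eq → injective E (g-injective _ _ (sound E i) (sound E j) eq)
    ; sound     = λ i → g-sound _ (sound E i)
    ; complete  = λ Qb → let a , p , ga≡b = g-complete Qb
                             i , enum-i≡a = complete E p
                         in i , trans (g-cong (sound E i) p enum-i≡a) ga≡b
    }
    where
    g-cong : ∀ {a a′} (p : P a) (p′ : P a′) → a ≡ a′ → g a p ≡ g a′ p′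
    g-cong _ _ refl = refl

_⊎ᴱ_ : {P : A → Set} {Q : B → Set} → Enumeration I P → Enumeration J Q → Enumeration (I ⊎ J) [ P , Q ]′
E ⊎ᴱ F = record
  { enum      = Sum.map (enum E) (enum F)
  ; injective = λ { {inj₁ _} {inj₁ _} eq → cong inj₁ (injective E (inj₁-injective eq))
                  ; {inj₂ _} {inj₂ _} eq → cong inj₂ (injective F (inj₂-injective eq)) }
  ; sound     = λ { (inj₁ i) → sound E i ; (inj₂ j) → sound F j }
  ; complete  = λ { {inj₁ a} Pa → Product.map inj₁ (cong inj₁) (complete E Pa)
                  ; {inj₂ b} Qb → Product.map inj₂ (cong inj₂) (complete F Qb) }
  }

-- Standard cycle form and the inverse of θ

BodyBelowHead : Cycle n → Set
BodyBelowHead (h , b) = All (_≤ᶠ h) b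

HeadsIncreasing : List (Cycle n) → Set
HeadsIncreasing = Linked (λ c d → proj₁ c <ᶠ proj₁ d)

IsStandard : List (Cycle n) → Set
IsStandard cs = All BodyBelowHead cs × HeadsIncreasing cs

-- θ⁻¹ on one-line notation: a new cycle opens at every left-to-right maximum.
splitFrom : Fin n → List (Fin n) → List (Fin n) × List (Cycle n)
openCycle : Fin n → List (Fin n) → List (Cycle n)

splitFrom h []       = [] , []
splitFrom h (y ∷ ys) with h <? y
... | yes _ = [] , openCycle y ys
... | no  _ = map₁ (y ∷_) (splitFrom h ys)

openCycle h ys = (h , proj₁ (splitFrom h ys)) ∷ proj₂ (splitFrom h ys)

splitCycles : List (Fin n) → List (Cycle n)
splitCycles []       = []
splitCycles (x ∷ xs) = openCycle x xs

flatten-splitFrom : ∀ (h : Fin n) ys → proj₁ (splitFrom h ys) ++ flatten (proj₂ (splitFrom h ys)) ≡ ys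
flatten-splitFrom h []       = refl
flatten-splitFrom h (y ∷ ys) with h <? y
... | yes _ = cong (y ∷_) (flatten-splitFrom y ys)
... | no  _ = cong (y ∷_) (flatten-splitFrom h ys)

flatten-splitCycles : (l : List (Fin n)) → flatten (splitCycles l) ≡ l
flatten-splitCycles []       = refl
flatten-splitCycles (x ∷ xs) = cong (x ∷_) (flatten-splitFrom x xs)

splitFrom-below : ∀ (h : Fin n) ys → All (_≤ᶠ h) (proj₁ (splitFrom h ys))
splitFrom-below h []       = []
splitFrom-below h (y ∷ ys) with h <? y
... | yes _   = []
... | no  h≮y = ≮⇒≥ h≮y ∷ splitFrom-below h ys

openCycle-standard : ∀ (h : Fin n) ys → IsStandard (openCycle h ys)
splitFrom-standard : ∀ (h : Fin n) b ys → All (_≤ᶠ h) b → IsStandard ((h , b) ∷ proj₂ (splitFrom h ys))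

openCycle-standard h ys = splitFrom-standard h _ ys (splitFrom-below h ys)

splitFrom-standard h b []       b≤h = b≤h ∷ [] , [-]
splitFrom-standard h b (y ∷ ys) b≤h with h <? y
... | yes h<y = let below , increasing = openCycle-standard y ys in b≤h ∷ below , h<y ∷ increasing
... | no  _   = splitFrom-standard h b ys b≤h

splitCycles-standard : (l : List (Fin n)) → IsStandard (splitCycles l)
splitCycles-standard []       = [] , []
splitCycles-standard (x ∷ xs) = openCycle-standard x xs

splitFrom-flatten : ∀ (h : Fin n) b cs → All (_≤ᶠ h) b → IsStandard ((h , b) ∷ cs) →
                    splitFrom h (b ++ flatten cs) ≡ (b , cs)
splitFrom-flatten h [] [] _ _ = refl
splitFrom-flatten h [] ((h′ , b′) ∷ cs) _ (_ ∷ std@(b′≤h′ ∷ _) , h<h′ ∷ increasing) with h <? h′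
... | yes _    = cong (λ r → [] , (h′ , proj₁ r) ∷ proj₂ r)
                      (splitFrom-flatten h′ b′ cs b′≤h′ (std , increasing))
... | no  h≮h′ = ⊥-elim (h≮h′ h<h′)
splitFrom-flatten h (y ∷ b) cs (y≤h ∷ b≤h) (_ ∷ std , increasing) with h <? y
... | yes h<y = ⊥-elim (<⇒≱ h<y y≤h)
... | no  _   = cong (map₁ (y ∷_)) (splitFrom-flatten h b cs b≤h (b≤h ∷ std , relink increasing))
  where
  relink : ∀ {b b′ cs} → HeadsIncreasing ((h , b) ∷ cs) → HeadsIncreasing ((h , b′) ∷ cs)
  relink [-]      = [-]
  relink (r ∷ rs) = r ∷ rs

splitCycles-flatten : ∀ {cs : List (Cycle n)} → IsStandard cs → splitCycles (flatten cs) ≡ cs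
splitCycles-flatten {cs = []}           _                  = refl
splitCycles-flatten {cs = (h , b) ∷ cs} std@(b≤h ∷ _ , _) =
  cong (λ r → (h , proj₁ r) ∷ proj₂ r) (splitFrom-flatten h b cs b≤h std)

stdCycleForm-unique : ∀ {σ : Vec (Fin n) n} {cs l} → StdCycleForm σ cs → flatten cs ≡ l → cs ≡ splitCycles l
stdCycleForm-unique (std , increasing , _) refl = sym (splitCycles-flatten (All.map proj₂ std , increasing))

module _ {A : Set} (_≟ᴬ_ : DecidableEquality A) where

  successor : A → List (A × A) → A
  successor u []             = u
  successor u ((a , b) ∷ es) with u ≟ᴬ a
  ... | yes _ = b
  ... | no  _ = successor u es

  successor-∈ : ∀ {es : List (A × A)} {u v} → Unique (map proj₁ es) → (u , v) ∈ es → successor u es ≡ v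
  successor-∈ {(a , b) ∷ es} (_ ∷ _) (here refl) with a ≟ᴬ a
  ... | yes _  = refl
  ... | no a≢a = ⊥-elim (a≢a refl)
  successor-∈ {(a , b) ∷ es} {u} (a∉es ∷ unique) (there uv∈es) with u ≟ᴬ a
  ... | yes refl = ⊥-elim (All.lookup a∉es (∈-map⁺ proj₁ uv∈es) refl)
  ... | no  _    = successor-∈ unique uv∈es

  successor-defined : ∀ {es : List (A × A)} {u} → u ∈ map proj₁ es → (u , successor u es) ∈ es
  successor-defined {(a , b) ∷ es} {u} u∈es with u ≟ᴬ a | u∈es
  ... | yes refl | _           = here refl
  ... | no  u≢a  | here u≡a    = ⊥-elim (u≢a u≡a)
  ... | no  _    | there u∈es′ = there (successor-defined u∈es′)

  predecessor-unique : ∀ {es : List (A × A)} {u u′ v} → Unique (map proj₂ es) →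
                       (u , v) ∈ es → (u′ , v) ∈ es → u ≡ u′
  predecessor-unique {_ ∷ _} _            (here refl) (here refl) = refl
  predecessor-unique {_ ∷ _} (v∉es ∷ _)   (here refl) (there q)   =
    ⊥-elim (All.lookup v∉es (∈-map⁺ proj₂ q) refl)
  predecessor-unique {_ ∷ _} (v∉es ∷ _)   (there p)   (here refl) =
    ⊥-elim (All.lookup v∉es (∈-map⁺ proj₂ p) refl)
  predecessor-unique {_ ∷ _} (_ ∷ unique) (there p)   (there q)   = predecessor-unique unique p q

cycleEdgesFrom : Fin n → Fin n → List (Fin n) → List (Fin n × Fin n)
cycleEdgesFrom h x []       = (x , h) ∷ []
cycleEdgesFrom h x (y ∷ ys) = (x , y) ∷ cycleEdgesFrom h y ys

cycleEdges : Cycle n → List (Fin n × Fin n)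
cycleEdges (h , b) = cycleEdgesFrom h h b

edges : List (Cycle n) → List (Fin n × Fin n)
edges = concatMap cycleEdges

sources-cycleEdgesFrom : ∀ (h x : Fin n) b → map proj₁ (cycleEdgesFrom h x b) ≡ x ∷ b
sources-cycleEdgesFrom h x []      = refl
sources-cycleEdgesFrom h x (y ∷ b) = cong (x ∷_) (sources-cycleEdgesFrom h y b)

targets-cycleEdgesFrom : ∀ (h x : Fin n) b → map proj₂ (cycleEdgesFrom h x b) ≡ b ∷ʳ h
targets-cycleEdgesFrom h x []      = refl
targets-cycleEdgesFrom h x (y ∷ b) = cong (y ∷_) (targets-cycleEdgesFrom h y b)

sources-edges : (cs : List (Cycle n)) → map proj₁ (edges cs) ≡ flatten cs
sources-edges cs = trans (map-concatMap proj₁ cycleEdges cs)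
                         (concatMap-cong (λ (h , b) → sources-cycleEdgesFrom h h b) cs)

targets-edges : (cs : List (Cycle n)) → map proj₂ (edges cs) ↭ flatten cs
targets-edges []             = ↭-reflexive refl
targets-edges ((h , b) ∷ cs) = begin
  map proj₂ (cycleEdgesFrom h h b ++ edges cs)             ≡⟨ map-++ proj₂ (cycleEdgesFrom h h b) (edges cs) ⟩
  map proj₂ (cycleEdgesFrom h h b) ++ map proj₂ (edges cs) ≡⟨ cong (_++ _) (targets-cycleEdgesFrom h h b) ⟩
  (b ∷ʳ h) ++ map proj₂ (edges cs)                         ↭⟨ ↭.++⁺ (↭-sym (↭.∷↭∷ʳ h b)) (targets-edges cs) ⟩
  (h ∷ b) ++ flatten cs                                    ∎
  where open PermutationReasoning

path-from-edges : ∀ (σ : Vec (Fin n) n) h x b →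
                  All (λ (u , v) → lookup σ u ≡ v) (cycleEdgesFrom h x b) → Path σ x b h
path-from-edges σ h x []      (σx≡h ∷ []) = σx≡h
path-from-edges σ h x (y ∷ b) (σx≡y ∷ es) = σx≡y , path-from-edges σ h y b es

module CyclePermutation (cs : List (Cycle n)) (unique : Unique (flatten cs)) (covers : ∀ x → x ∈ flatten cs) where

  σ : Vec (Fin n) n
  σ = tabulate (λ u → successor _≟_ u (edges cs))

  private
    unique-sources : Unique (map proj₁ (edges cs))
    unique-sources = subst Unique (sym (sources-edges cs)) unique

    unique-targets : Unique (map proj₂ (edges cs))
    unique-targets = Unique-resp-↭ (↭-sym (targets-edges cs)) unique

  σ-edge : ∀ {u v} → (u , v) ∈ edges cs → lookup σ u ≡ v
  σ-edge {u} uv∈es = trans (lookup∘tabulate _ u) (successor-∈ _≟_ unique-sources uv∈es)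

  edge-σ : ∀ u → (u , lookup σ u) ∈ edges cs
  edge-σ u = subst (λ v → (u , v) ∈ edges cs) (sym (lookup∘tabulate _ u))
               (successor-defined _≟_ (subst (u ∈_) (sym (sources-edges cs)) (covers u)))

  σ-perm : IsPerm σ
  σ-perm i j σi≡σj = predecessor-unique _≟_ unique-targets (edge-σ i)
                       (subst (λ v → (j , v) ∈ edges cs) (sym σi≡σj) (edge-σ j))

  σ-cycles : All (λ (h , b) → Path σ h b h) cs
  σ-cycles = All.map (λ {(h , b)} → path-from-edges σ h h b) (Allₚ.map⁻ (Allₚ.concat⁻ (All.tabulate σ-edge)))

module _ (π : Vec (Fin n) n) (π-perm : IsPerm π) where

  unique-splitCycles : Unique (flatten (splitCycles (toList π)))
  unique-splitCycles = subst Unique (sym (flatten-splitCycles (toList π))) (lookupInjective⇒unique π π-perm)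

  covers-splitCycles : ∀ x → x ∈ flatten (splitCycles (toList π))
  covers-splitCycles x = subst (x ∈_) (sym (flatten-splitCycles (toList π))) (perm⇒∈ π π-perm x)

θ⁻¹-exists : (π : Vec (Fin n) n) → IsPerm π → Σ (Vec (Fin n) n) λ σ → IsPerm σ × Θ σ π
θ⁻¹-exists π π-perm =
  σ , σ-perm , splitCycles (toList π) , (All.zip (σ-cycles , proj₁ standard) , proj₂ standard , flatten↭allFin) ,
  flatten-splitCycles (toList π)
  where
  open CyclePermutation (splitCycles (toList π)) (unique-splitCycles π π-perm) (covers-splitCycles π π-perm)
  standard = splitCycles-standard (toList π)
  flatten↭allFin = unique∧covers⇒↭allFin (unique-splitCycles π π-perm) (covers-splitCycles π π-perm)

-- Avoiding (12 ; 1→2) means decreasing cycles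

Decreasing : List (Fin n) → Set
Decreasing = Linked (λ x y → y <ᶠ x)

DecreasingCycle : Cycle n → Set
DecreasingCycle c = Decreasing (cycleList c)

increasing₂ : ∀ {a b : Fin n} → a <ᶠ b → StrictlyIncreasing (lookup (a ∷ b ∷ []))
increasing₂ a<b zero       (suc zero) _        = a<b
increasing₂ a<b (suc zero) (suc zero) (s≤s ())

decreasingCycle-ascent : ∀ {σ : Vec (Fin n) n} {x b h z} → Path σ x b h → Decreasing (x ∷ b) →
                         z ∈ x ∷ b → z <ᶠ lookup σ z → lookup σ z ≡ h
decreasingCycle-ascent {b = []}    σx≡h       _         (here refl) _    = σx≡h
decreasingCycle-ascent {b = _ ∷ _} (refl , _) (y<x ∷ _) (here refl) x<σx = ⊥-elim (<-asym y<x x<σx)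
decreasingCycle-ascent {b = _ ∷ _} (_ , path) (_ ∷ dec) (there z∈b) z<σz = decreasingCycle-ascent path dec z∈b z<σz

module _ {π σ : Vec (Fin n) n} (π-perm : IsPerm π) where

  occurrence : ∀ {a b} xs {ys} → a <ᶠ b → lookup σ a ≡ b → toList π ≡ xs ++ a ∷ ys → b ∈ ys →
               Occurs pat12 π σ
  occurrence {a} {b} xs a<b σa≡b eq b∈ys =
    let i , j , i<j , πi≡a , πj≡b = before⇒indices π xs eq b∈ys
    in lookup (a ∷ b ∷ []) , increasing₂ a<b , lookup (i ∷ j ∷ []) , increasing₂ i<j ,
       (λ { zero → πi≡a ; (suc zero) → πj≡b }) , σa≡b ∷ []

  adjacent-descent : ¬ Occurs pat12 π σ → ∀ xs {a b ys} → toList π ≡ xs ++ a ∷ b ∷ ys →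
                     lookup σ a ≡ b → b <ᶠ a
  adjacent-descent avoid xs {a} {b} eq σa≡b with <-cmp a b
  ... | tri< a<b _ _  = ⊥-elim (avoid (occurrence xs a<b σa≡b eq (here refl)))
  ... | tri> _ _ b<a  = b<a
  ... | tri≈ _ refl _ =
    let i , j , i<j , πi≡a , πj≡a = before⇒indices π xs eq (here refl)
    in ⊥-elim (Finₚ.<-irrefl (π-perm i j (trans πi≡a (sym πj≡a))) i<j)

  path-decreasing : ¬ Occurs pat12 π σ → ∀ xs {x b h} ys → toList π ≡ xs ++ x ∷ b ++ ys →
                    Path σ x b h → Decreasing (x ∷ b)
  path-decreasing avoid xs {b = []}    ys eq _             = [-]
  path-decreasing avoid xs {x} {y ∷ b} ys eq (σx≡y , path) =
    adjacent-descent avoid xs eq σx≡y ∷ path-decreasing avoid (xs ++ [ x ]) ys eq′ path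
    where eq′ = trans eq (sym (++-assoc xs [ x ] (y ∷ b ++ ys)))

  ¬occurs⇒decreasing : ¬ Occurs pat12 π σ → ∀ xs {cs} → toList π ≡ xs ++ flatten cs →
                       All (IsStdCycle σ) cs → All DecreasingCycle cs
  ¬occurs⇒decreasing avoid xs {[]}           _  []                = []
  ¬occurs⇒decreasing avoid xs {(h , b) ∷ cs} eq ((path , _) ∷ std) =
    path-decreasing avoid xs (flatten cs) eq path ∷ ¬occurs⇒decreasing avoid (xs ++ h ∷ b) eq′ std
    where eq′ = trans eq (sym (++-assoc xs (h ∷ b) (flatten cs)))

  ascent⇒target-precedes : ∀ xs {cs x} → toList π ≡ xs ++ flatten cs → All (IsStdCycle σ) cs →
                           All DecreasingCycle cs → x ∈ flatten cs → x <ᶠ lookup σ x →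
                           ∃₂ λ ys zs → toList π ≡ ys ++ lookup σ x ∷ zs × x ∈ zs
  ascent⇒target-precedes xs {(h , b) ∷ cs} {x} eq ((path , _) ∷ std) (dec ∷ decs) x∈ x<σx
    with ∈-++⁻ (h ∷ b) x∈
  ... | inj₁ x∈hb with decreasingCycle-ascent path dec x∈hb x<σx | x∈hb
  ...   | σx≡h | here refl = ⊥-elim (Finₚ.<-irrefl (sym σx≡h) x<σx)
  ...   | σx≡h | there x∈b =
    xs , b ++ flatten cs , subst (λ y → toList π ≡ xs ++ y ∷ b ++ flatten cs) (sym σx≡h) eq , ∈-++⁺ˡ x∈b
  ascent⇒target-precedes xs {(h , b) ∷ cs} eq (_ ∷ std) (_ ∷ decs) _ x<σx | inj₂ x∈cs =
    ascent⇒target-precedes (xs ++ h ∷ b) (trans eq (sym (++-assoc xs (h ∷ b) (flatten cs)))) std decs x∈cs x<σx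

  decreasing⇒¬occurs : ∀ {cs} → toList π ≡ flatten cs → All (IsStdCycle σ) cs → All DecreasingCycle cs →
                       ¬ Occurs pat12 π σ
  decreasing⇒¬occurs {cs} eq std decs (x , x-inc , t , t-inc , πt≡x , (σx₀≡x₁ ∷ [])) = <-asym t₀<t₁ t₁<t₀
    where
    t₀<t₁ = t-inc zero (suc zero) (s≤s z≤n)
    x₀∈cs : x zero ∈ flatten cs
    x₀∈cs = subst (x zero ∈_) eq (subst (_∈ toList π) (πt≡x zero) (∈-toList⁺ (∈-lookup (t zero) π)))
    ascent : x zero <ᶠ lookup σ (x zero)
    ascent = subst (x zero <ᶠ_) (sym σx₀≡x₁) (x-inc zero (suc zero) (s≤s z≤n))
    t₁<t₀ : t (suc zero) <ᶠ t zero
    t₁<t₀ = let ys , zs , eq′ , x₀∈zs = ascent⇒target-precedes [] {cs} eq std decs x₀∈cs ascent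
                i , j , i<j , πi≡σx₀ , πj≡x₀ = before⇒indices π ys eq′ x₀∈zs
            in subst₂ _<ᶠ_ (π-perm i _ (trans πi≡σx₀ (trans σx₀≡x₁ (sym (πt≡x (suc zero))))))
                           (π-perm j _ (trans πj≡x₀ (sym (πt≡x zero)))) i<j

avoids⇒decreasing : {π : Vec (Fin n) n} → IsPerm π → Avoids pat12 π → All DecreasingCycle (splitCycles (toList π))
avoids⇒decreasing {π = π} π-perm avoid with σ , σ-perm , (cs , form@(std , _ , _) , flat) ← θ⁻¹-exists π π-perm =
  subst (All DecreasingCycle) (stdCycleForm-unique form flat)
    (¬occurs⇒decreasing π-perm (λ occ → avoid (σ , σ-perm , (cs , form , flat) , occ)) [] (sym flat) std)

decreasing⇒avoids : {π : Vec (Fin n) n} → IsPerm π → All DecreasingCycle (splitCycles (toList π)) → Avoids pat12 π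
decreasing⇒avoids π-perm decs (σ , _ , (cs , form@(std , _ , _) , flat) , occ) =
  decreasing⇒¬occurs π-perm (sym flat) std (subst (All DecreasingCycle) (sym (stdCycleForm-unique form flat)) decs) occ

-- Set partitions as canonical cycle lists

record IsCanonicalPartition (cs : List (Cycle n)) : Set where
  field
    unique     : Unique (flatten cs)
    covers     : ∀ x → x ∈ flatten cs
    increasing : HeadsIncreasing cs
    decreasing : All DecreasingCycle cs

open IsCanonicalPartition

canonical⇒standard : {cs : List (Cycle n)} → IsCanonicalPartition cs → IsStandard cs
canonical⇒standard p = All.map below (decreasing p) , increasing p
  where
  below : ∀ {c : Cycle n} → DecreasingCycle c → BodyBelowHead c
  below dec with b<h ∷ _ ← Linkedₚ.Linked⇒AllPairs (λ y<x z<y → Finₚ.<-trans z<y y<x) dec = All.map <⇒≤ b<h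

length-flatten : {cs : List (Cycle n)} → IsCanonicalPartition cs → length (flatten cs) ≡ n
length-flatten {n} p = trans (↭.↭-length (unique∧covers⇒↭allFin (unique p) (covers p))) (length-tabulate {n = n} id)

length≤length-flatten : (cs : List (Cycle n)) → length cs ≤ length (flatten cs)
length≤length-flatten []             = z≤n
length≤length-flatten ((h , b) ∷ cs) = s≤s (≤-trans (length≤length-flatten cs) (length-++-≤ʳ (flatten cs) {b}))

liftCycle : Cycle n → Cycle (suc n)
liftCycle (h , b) = suc h , map suc b

newBlock : List (Cycle n) → List (Cycle (suc n))
newBlock cs = (zero , []) ∷ map liftCycle cs

snocAt : ℕ → Fin n → List (Cycle n) → List (Cycle n)
snocAt _       z []             = []
snocAt zero    z ((h , b) ∷ cs) = (h , b ∷ʳ z) ∷ cs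
snocAt (suc r) z (c ∷ cs)       = c ∷ snocAt r z cs

joinBlock : ℕ → List (Cycle n) → List (Cycle (suc n))
joinBlock r cs = snocAt r zero (map liftCycle cs)

flatten-lift : (cs : List (Cycle n)) → flatten (map liftCycle cs) ≡ map suc (flatten cs)
flatten-lift cs = trans (concatMap-map cycleList liftCycle cs) (sym (map-concatMap suc cycleList cs))

flatten-snocAt : ∀ r (z : Fin n) cs → r < length cs → flatten (snocAt r z cs) ↭ z ∷ flatten cs
flatten-snocAt zero z ((h , b) ∷ cs) _ =
  ↭-trans (↭-reflexive (cong (h ∷_) (++-assoc b [ z ] (flatten cs)))) (↭.shift z (h ∷ b) (flatten cs))
flatten-snocAt (suc r) z (c ∷ cs) (s≤s r<) =
  ↭-trans (↭.++⁺ˡ (cycleList c) (flatten-snocAt r z cs r<)) (↭.shift z (cycleList c) (flatten cs))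

heads-snocAt : ∀ r (z : Fin n) cs → map proj₁ (snocAt r z cs) ≡ map proj₁ cs
heads-snocAt _       z []       = refl
heads-snocAt zero    z (c ∷ cs) = refl
heads-snocAt (suc r) z (c ∷ cs) = cong (proj₁ c ∷_) (heads-snocAt r z cs)

length-snocAt : ∀ r (z : Fin n) cs → length (snocAt r z cs) ≡ length cs
length-snocAt _       z []       = refl
length-snocAt zero    z (c ∷ cs) = refl
length-snocAt (suc r) z (c ∷ cs) = cong suc (length-snocAt r z cs)

decreasing-map-suc : {xs : List (Fin n)} → Decreasing xs ⇔ Decreasing (map suc xs)
decreasing-map-suc = mk⇔ (Linkedₚ.map⁺ ∘ Linked.map s≤s) (Linked.map s<s⁻¹ ∘ Linkedₚ.map⁻)

decreasing-snoc-zero : {xs : List (Fin n)} → Decreasing xs ⇔ Decreasing (map suc xs ∷ʳ zero)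
decreasing-snoc-zero = mk⇔ to from
  where
  to : ∀ {xs : List (Fin n)} → Decreasing xs → Decreasing (map suc xs ∷ʳ zero)
  to {xs = []}        _            = [-]
  to {xs = _ ∷ []}    _            = s≤s z≤n ∷ [-]
  to {xs = _ ∷ _ ∷ _} (y<x ∷ dec) = s≤s y<x ∷ to dec
  from : ∀ {xs : List (Fin n)} → Decreasing (map suc xs ∷ʳ zero) → Decreasing xs
  from {xs = []}        _            = []
  from {xs = _ ∷ []}    _            = [-]
  from {xs = _ ∷ _ ∷ _} (y<x ∷ dec) = s<s⁻¹ y<x ∷ from dec

decreasingCycles-lift : {cs : List (Cycle n)} → All DecreasingCycle cs ⇔ All DecreasingCycle (map liftCycle cs)
decreasingCycles-lift = mk⇔ (Allₚ.map⁺ ∘ All.map (Equivalence.to decreasing-map-suc))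
                            (All.map (Equivalence.from decreasing-map-suc) ∘ Allₚ.map⁻)

decreasingCycles-joinBlock : ∀ r {cs : List (Cycle n)} → All DecreasingCycle cs ⇔ All DecreasingCycle (joinBlock r cs)
decreasingCycles-joinBlock r = mk⇔ (to r) (from r)
  where
  to : ∀ r {cs : List (Cycle n)} → All DecreasingCycle cs → All DecreasingCycle (joinBlock r cs)
  to r       []            = []
  to zero    (dec ∷ decs)  = Equivalence.to decreasing-snoc-zero dec ∷ Equivalence.to decreasingCycles-lift decs
  to (suc r) (dec ∷ decs)  = Equivalence.to decreasing-map-suc dec ∷ to r decs
  from : ∀ r {cs : List (Cycle n)} → All DecreasingCycle (joinBlock r cs) → All DecreasingCycle cs
  from r       {[]}    _             = []
  from zero    {_ ∷ _} (dec ∷ decs)  =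
    Equivalence.from decreasing-snoc-zero dec ∷ Equivalence.from decreasingCycles-lift decs
  from (suc r) {_ ∷ _} (dec ∷ decs)  = Equivalence.from decreasing-map-suc dec ∷ from r decs

increasing-lift : {cs : List (Cycle n)} → HeadsIncreasing cs ⇔ HeadsIncreasing (map liftCycle cs)
increasing-lift = mk⇔ (Linkedₚ.map⁺ ∘ Linked.map s≤s) (Linked.map s<s⁻¹ ∘ Linkedₚ.map⁻)

increasing-snocAt : ∀ r (z : Fin n) {cs} → HeadsIncreasing cs ⇔ HeadsIncreasing (snocAt r z cs)
increasing-snocAt r z {cs} = mk⇔
  (Linkedₚ.map⁻ ∘ subst (Linked _<ᶠ_) (sym (heads-snocAt r z cs)) ∘ Linkedₚ.map⁺)
  (Linkedₚ.map⁻ ∘ subst (Linked _<ᶠ_) (heads-snocAt r z cs) ∘ Linkedₚ.map⁺)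

-- cs′ is obtained from cs by shifting every element up and inserting a new least element 0.
record Extension (cs : List (Cycle n)) (cs′ : List (Cycle (suc n))) : Set where
  field
    flatten↭    : flatten cs′ ↭ zero ∷ map suc (flatten cs)
    increasing⇔ : HeadsIncreasing cs ⇔ HeadsIncreasing cs′
    decreasing⇔ : All DecreasingCycle cs ⇔ All DecreasingCycle cs′

extension-canonical : ∀ {cs : List (Cycle n)} {cs′} → Extension cs cs′ →
                      IsCanonicalPartition cs ⇔ IsCanonicalPartition cs′
extension-canonical ext = mk⇔
  (λ p → record
    { unique     = Unique-resp-↭ (↭-sym flatten↭) (Equivalence.to unique-extend (unique p))
    ; covers     = λ x → ↭.∈-resp-↭ (↭-sym flatten↭) (Equivalence.to covers-extend (covers p) x)
    ; increasing = Equivalence.to increasing⇔ (increasing p)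
    ; decreasing = Equivalence.to decreasing⇔ (decreasing p) })
  (λ p → record
    { unique     = Equivalence.from unique-extend (Unique-resp-↭ flatten↭ (unique p))
    ; covers     = Equivalence.from covers-extend (λ x → ↭.∈-resp-↭ flatten↭ (covers p x))
    ; increasing = Equivalence.from increasing⇔ (increasing p)
    ; decreasing = Equivalence.from decreasing⇔ (decreasing p) })
  where open Extension ext

newBlock-extension : (cs : List (Cycle n)) → Extension cs (newBlock cs)
newBlock-extension cs = record
  { flatten↭    = ↭-reflexive (cong (zero ∷_) (flatten-lift cs))
  ; increasing⇔ = mk⇔ (cons-zero ∘ Equivalence.to increasing-lift) (Equivalence.from increasing-lift ∘ Linked.tail)
  ; decreasing⇔ = mk⇔ (λ decs → [-] ∷ Equivalence.to decreasingCycles-lift decs)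
                      (λ { (_ ∷ decs) → Equivalence.from decreasingCycles-lift decs })
  }
  where
  cons-zero : ∀ {cs : List (Cycle n)} → HeadsIncreasing (map liftCycle cs) →
              HeadsIncreasing ((zero , []) ∷ map liftCycle cs)
  cons-zero {cs = []}    _   = [-]
  cons-zero {cs = _ ∷ _} inc = s≤s z≤n ∷ inc

joinBlock-extension : ∀ r (cs : List (Cycle n)) → r < length cs → Extension cs (joinBlock r cs)
joinBlock-extension r cs r<len = record
  { flatten↭    = ↭-trans (flatten-snocAt r zero (map liftCycle cs) (subst (r <_) (sym (length-map liftCycle cs)) r<len))
                          (↭-prep zero (↭-reflexive (flatten-lift cs)))
  ; increasing⇔ = mk⇔ (Equivalence.to (increasing-snocAt r zero) ∘ Equivalence.to increasing-lift)
                      (Equivalence.from increasing-lift ∘ Equivalence.from (increasing-snocAt r zero))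
  ; decreasing⇔ = decreasingCycles-joinBlock r
  }

lower : {xs : List (Fin (suc n))} → zero ∉ xs → ∃ λ ys → xs ≡ map suc ys
lower {xs = []}         _  = [] , refl
lower {xs = zero ∷ _}   0∉ = ⊥-elim (0∉ (here refl))
lower {xs = suc y ∷ xs} 0∉ with ys , refl ← lower {xs = xs} (0∉ ∘ there) = y ∷ ys , refl

lowerCycles : {cs : List (Cycle (suc n))} → zero ∉ flatten cs → ∃ λ cs′ → cs ≡ map liftCycle cs′
lowerCycles {cs = []} _ = [] , refl
lowerCycles {cs = (h , b) ∷ cs} 0∉
  with lower {xs = h ∷ b} (0∉ ∘ ∈-++⁺ˡ) | lowerCycles {cs = cs} (0∉ ∘ ∈-++⁺ʳ (h ∷ b))
... | h′ ∷ b′ , refl | cs′ , refl = (h′ , b′) ∷ cs′ , refl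

zero-last : ∀ {x : Fin (suc n)} {b} → Decreasing (x ∷ b) → zero ∈ b → ∃ λ b′ → b ≡ b′ ∷ʳ zero
zero-last {b = _ ∷ []}    _                 (here refl) = [] , refl
zero-last {b = _ ∷ _ ∷ _} (_ ∷ () ∷ _)      (here refl)
zero-last {b = y ∷ _}     (_ ∷ dec)         (there 0∈b) with b′ , refl ← zero-last dec 0∈b = y ∷ b′ , refl

InsertionShape : List (Cycle (suc n)) → Set
InsertionShape {n} cs = (∃ λ (cs′ : List (Cycle n)) → cs ≡ newBlock cs′)
                      ⊎ (∃₂ λ r (cs′ : List (Cycle n)) → r < length cs′ × cs ≡ joinBlock r cs′)

-- 0 is the least element: either it heads the first cycle alone, or it ends some cycle.
insertionShape : ∀ {cs : List (Cycle (suc n))} → Unique (flatten cs) → HeadsIncreasing cs →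
                 All DecreasingCycle cs → zero ∈ flatten cs → InsertionShape cs
insertionShape {cs = (zero , []) ∷ cs} (0∉ ∷ _) _ _ _
  with cs′ , refl ← lowerCycles {cs = cs} (λ 0∈ → All.lookup 0∉ 0∈ refl) = inj₁ (cs′ , refl)
insertionShape {cs = (zero , _ ∷ _) ∷ _} _ _ ((() ∷ _) ∷ _) _
insertionShape {cs = (suc h , b) ∷ cs} u inc (dec ∷ decs) 0∈ with ∈-++⁻ (suc h ∷ b) 0∈
... | inj₁ (there 0∈b) with zero-last dec 0∈b
...   | b′ , refl with lowerCycles {cs = (suc h , b′) ∷ cs} (unique-remove (suc h ∷ b′)
                         (subst Unique (cong (suc h ∷_) (++-assoc b′ [ zero ] (flatten cs))) u))
...     | (h′ , b″) ∷ cs′ , refl = inj₂ (0 , (h′ , b″) ∷ cs′ , s≤s z≤n , refl)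
insertionShape {cs = (suc h , b) ∷ cs} u inc (dec ∷ decs) 0∈ | inj₂ 0∈cs
  with insertionShape {cs = cs} (unique-++ʳ (suc h ∷ b) u) (Linked.tail inc) decs 0∈cs
... | inj₁ (_ , refl) with () ← Linked.head inc
... | inj₂ (r , cs′ , r< , refl) with b′ , refl ← lower {xs = b} (unique-disjoint (suc h ∷ b) u 0∈cs ∘ there) =
  inj₂ (suc r , (h , b′) ∷ cs′ , s≤s r< , refl)

liftCycle-injective : ∀ {c d : Cycle n} → liftCycle c ≡ liftCycle d → c ≡ d
liftCycle-injective {c = h , b} {h′ , b′} eq =
  cong₂ _,_ (Finₚ.suc-injective (cong proj₁ eq)) (map-injective Finₚ.suc-injective (cong proj₂ eq))

newBlock-injective : ∀ {cs cs′ : List (Cycle n)} → newBlock cs ≡ newBlock cs′ → cs ≡ cs′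
newBlock-injective = map-injective liftCycle-injective ∘ ∷-injectiveʳ

zero∉map-suc : (xs : List (Fin n)) → zero ∉ map suc xs
zero∉map-suc {n} xs 0∈ with _ , _ , () ← ∈-map⁻ (Data.Fin.suc {n}) 0∈

snocZero≢liftCycle : ∀ {h h′ : Fin n} {b b′} → (suc h , map suc b ∷ʳ zero) ≢ liftCycle (h′ , b′)
snocZero≢liftCycle {b = b} {b′ = b′} eq =
  zero∉map-suc b′ (subst (zero ∈_) (cong proj₂ eq) (∈-++⁺ʳ (map suc b) (here refl)))

joinBlock-injective : ∀ r r′ (cs cs′ : List (Cycle n)) → r < length cs → r′ < length cs′ →
                      joinBlock r cs ≡ joinBlock r′ cs′ → r ≡ r′ × cs ≡ cs′
joinBlock-injective zero zero ((h , b) ∷ cs) ((h′ , b′) ∷ cs′) _ _ eq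
  with first , rest ← ∷-injective eq =
  refl , cong₂ _∷_ (cong₂ _,_ (Finₚ.suc-injective (cong proj₁ first))
                              (map-injective Finₚ.suc-injective (∷ʳ-injectiveˡ _ _ (cong proj₂ first))))
                   (map-injective liftCycle-injective rest)
joinBlock-injective zero (suc r′) (_ ∷ _) (_ ∷ _) _ _ eq = ⊥-elim (snocZero≢liftCycle (∷-injectiveˡ eq))
joinBlock-injective (suc r) zero (_ ∷ _) (_ ∷ _) _ _ eq = ⊥-elim (snocZero≢liftCycle (sym (∷-injectiveˡ eq)))
joinBlock-injective (suc r) (suc r′) (c ∷ cs) (c′ ∷ cs′) (s≤s r<) (s≤s r′<) eq
  with first , rest ← ∷-injective eq
  with refl , refl ← joinBlock-injective r r′ cs cs′ r< r′< rest =
  refl , cong (_∷ cs) (liftCycle-injective first)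

newBlock≢joinBlock : ∀ {r} {cs cs′ : List (Cycle n)} → r < length cs′ → newBlock cs ≢ joinBlock r cs′
newBlock≢joinBlock {r = zero}  {cs′ = _ ∷ _} _ ()
newBlock≢joinBlock {r = suc r} {cs′ = _ ∷ _} _ ()

-- Counting by the Stirling recursion

PartitionInto : ℕ → List (Cycle n) → Set
PartitionInto j cs = IsCanonicalPartition cs × length cs ≡ j

InsertionData : ℕ → ℕ → Set
InsertionData n j = (Fin (suc j) × List (Cycle n)) ⊎ List (Cycle n)

insertZero : ∀ {j} → InsertionData n j → List (Cycle (suc n))
insertZero (inj₁ (r , cs)) = joinBlock (toℕ r) cs
insertZero (inj₂ cs)       = newBlock cs

module _ {n j : ℕ} where

  ValidInsertion : InsertionData n j → Set
  ValidInsertion = [ PartitionInto (suc j) ∘ proj₂ , PartitionInto j ]′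

  private
    index<length : ∀ (cs : List (Cycle n)) (r : Fin (suc j)) → length cs ≡ suc j → toℕ r < length cs
    index<length cs r len = subst (toℕ r <_) (sym len) (toℕ<n r)

  insertZero-injective : ∀ a a′ → ValidInsertion a → ValidInsertion a′ →
                         insertZero a ≡ insertZero a′ → a ≡ a′
  insertZero-injective (inj₁ (r , cs)) (inj₁ (r′ , cs′)) (_ , len) (_ , len′) eq
    with r≡r′ , refl ← joinBlock-injective (toℕ r) (toℕ r′) cs cs′
                          (index<length cs r len) (index<length cs′ r′ len′) eq =
    cong (λ r → inj₁ (r , cs)) (toℕ-injective r≡r′)
  insertZero-injective (inj₁ (r , cs)) (inj₂ cs′) (_ , len) _ eq =
    ⊥-elim (newBlock≢joinBlock (index<length cs r len) (sym eq))
  insertZero-injective (inj₂ cs) (inj₁ (r′ , cs′)) _ (_ , len′) eq =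
    ⊥-elim (newBlock≢joinBlock (index<length cs′ r′ len′) eq)
  insertZero-injective (inj₂ cs) (inj₂ cs′) _ _ eq = cong inj₂ (newBlock-injective eq)

  insertZero-sound : ∀ a → ValidInsertion a → PartitionInto (suc j) (insertZero a)
  insertZero-sound (inj₁ (r , cs)) (p , len) =
    Equivalence.to (extension-canonical (joinBlock-extension (toℕ r) cs (index<length cs r len))) p ,
    trans (length-snocAt (toℕ r) _ (map liftCycle cs)) (trans (length-map liftCycle cs) len)
  insertZero-sound (inj₂ cs) (p , len) =
    Equivalence.to (extension-canonical (newBlock-extension cs)) p , cong suc (trans (length-map liftCycle cs) len)

  insertZero-complete : ∀ {cs} → PartitionInto (suc j) cs →
                        ∃ λ a → Σ (ValidInsertion a) λ _ → insertZero a ≡ cs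
  insertZero-complete (p , len) with insertionShape (unique p) (increasing p) (decreasing p) (covers p _)
  ... | inj₁ (cs′ , refl) =
    inj₂ cs′ , (Equivalence.from (extension-canonical (newBlock-extension cs′)) p ,
                ℕₚ.suc-injective (trans (cong suc (sym (length-map liftCycle cs′))) len)) , refl
  ... | inj₂ (r , cs′ , r< , refl) =
    inj₁ (fromℕ< r<suc-j , cs′) , (Equivalence.from (extension-canonical (joinBlock-extension r cs′ r<)) p , len′) ,
    cong (λ k → joinBlock k cs′) (toℕ-fromℕ< r<suc-j)
    where
    len′ : length cs′ ≡ suc j
    len′ = trans (sym (trans (length-snocAt r _ (map liftCycle cs′)) (length-map liftCycle cs′))) len
    r<suc-j : r < suc j
    r<suc-j = subst (r <_) len′ r<

empty-canonical : IsCanonicalPartition {0} []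
empty-canonical = record { unique = [] ; covers = λ () ; increasing = [] ; decreasing = [] }

partitions : ∀ n j → Enumeration (Fin (stirling2 n j)) (PartitionInto {n} j)
partitions zero    zero    = singleton (empty-canonical , refl) (λ { {[]} _ → refl })
partitions zero    (suc j) = empty (λ { {[]} (_ , ()) ; {(() , _) ∷ _} _ })
partitions (suc n) zero    = empty (λ { {[]} (p , _) → ¬Any[] (covers p zero) ; {_ ∷ _} (_ , ()) })
partitions (suc n) (suc j) =
  image (λ a _ → insertZero a) insertZero-injective insertZero-sound insertZero-complete
    (reindex +↔⊎ (reindex *↔× (pairs (partitions n (suc j))) ⊎ᴱ partitions n j))

PartitionUpTo : ℕ → List (Cycle n) → Set
PartitionUpTo m cs = IsCanonicalPartition cs × length cs ≤ m

partitionsUpTo : ∀ n m → Enumeration (Fin (sumUpTo (stirling2 n) m)) (PartitionUpTo {n} m)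
partitionsUpTo n zero =
  image (λ cs _ → cs) (λ _ _ _ _ → id) (λ _ (p , len) → p , ≤-reflexive len)
        (λ (p , len) → _ , (p , n≤0⇒n≡0 len) , refl) (partitions n 0)
partitionsUpTo n (suc m) =
  image (λ a _ → Sum.reduce a) injective′ sound′ complete′
        (reindex +↔⊎ (partitionsUpTo n m ⊎ᴱ partitions n (suc m)))
  where
  Valid : List (Cycle n) ⊎ List (Cycle n) → Set
  Valid = [ PartitionUpTo m , PartitionInto (suc m) ]′
  injective′ : ∀ a a′ → Valid a → Valid a′ → Sum.reduce a ≡ Sum.reduce a′ → a ≡ a′
  injective′ (inj₁ _) (inj₁ _) _ _ refl = refl
  injective′ (inj₂ _) (inj₂ _) _ _ refl = refl
  injective′ (inj₁ _) (inj₂ _) (_ , ≤m) (_ , ≡suc-m) refl = ⊥-elim (ℕₚ.<-irrefl refl (subst (_≤ m) ≡suc-m ≤m))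
  injective′ (inj₂ _) (inj₁ _) (_ , ≡suc-m) (_ , ≤m) refl = ⊥-elim (ℕₚ.<-irrefl refl (subst (_≤ m) ≡suc-m ≤m))
  sound′ : ∀ a → Valid a → PartitionUpTo (suc m) (Sum.reduce a)
  sound′ (inj₁ _) (p , len) = p , m≤n⇒m≤1+n len
  sound′ (inj₂ _) (p , len) = p , ≤-reflexive len
  complete′ : ∀ {cs} → PartitionUpTo (suc m) cs → ∃ λ a → Σ (Valid a) λ _ → Sum.reduce a ≡ cs
  complete′ (p , len) with m≤n⇒m<n∨m≡n len
  ... | inj₁ len<suc-m = inj₁ _ , (p , s≤s⁻¹ len<suc-m) , refl
  ... | inj₂ len≡suc-m = inj₂ _ , (p , len≡suc-m) , refl

oneLine : (cs : List (Cycle n)) → .(PartitionUpTo n cs) → Vec (Fin n) n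
oneLine cs p = cast (length-flatten (proj₁ p)) (fromList (flatten cs))

toList-oneLine : (cs : List (Cycle n)) .(p : PartitionUpTo n cs) → toList (oneLine cs p) ≡ flatten cs
toList-oneLine cs p = trans (toList-cast _ (fromList (flatten cs))) (toList∘fromList (flatten cs))

oneLine-injective : ∀ cs cs′ (p : PartitionUpTo n cs) (p′ : PartitionUpTo n cs′) →
                    oneLine cs p ≡ oneLine cs′ p′ → cs ≡ cs′
oneLine-injective cs cs′ q@(p , _) q′@(p′ , _) eq = begin
  cs                       ≡⟨ splitCycles-flatten (canonical⇒standard p) ⟨
  splitCycles (flatten cs)  ≡⟨ cong splitCycles flatten-eq ⟩
  splitCycles (flatten cs′) ≡⟨ splitCycles-flatten (canonical⇒standard p′) ⟩
  cs′                      ∎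
  where
  open ≡-Reasoning
  flatten-eq = trans (sym (toList-oneLine cs q)) (trans (cong toList eq) (toList-oneLine cs′ q′))

oneLine-avoider : ∀ cs (p : PartitionUpTo n cs) → IsPerm (oneLine cs p) × Avoids pat12 (oneLine cs p)
oneLine-avoider cs q@(p , _) = π-perm , decreasing⇒avoids π-perm decreasing′
  where
  π-perm = unique⇒lookupInjective (oneLine cs q) (subst Unique (sym (toList-oneLine cs q)) (unique p))
  decreasing′ = subst (All DecreasingCycle)
                  (trans (sym (splitCycles-flatten (canonical⇒standard p))) (cong splitCycles (sym (toList-oneLine cs q))))
                  (decreasing p)

avoider-oneLine : ∀ {π : Vec (Fin n) n} → IsPerm π × Avoids pat12 π →
                  ∃ λ cs → Σ (PartitionUpTo n cs) λ p → oneLine cs p ≡ π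
avoider-oneLine {n} {π} (π-perm , avoid) =
  cs , (p , len) , vec-toList-injective _ π (trans (toList-oneLine cs (p , len)) flatten-cs)
  where
  cs = splitCycles (toList π)
  flatten-cs = flatten-splitCycles (toList π)
  p : IsCanonicalPartition cs
  p = record
    { unique     = unique-splitCycles π π-perm
    ; covers     = covers-splitCycles π π-perm
    ; increasing = proj₂ (splitCycles-standard (toList π))
    ; decreasing = avoids⇒decreasing π-perm avoid }
  len : length cs ≤ n
  len = ≤-trans (length≤length-flatten cs) (≤-reflexive (trans (cong length flatten-cs) (length-toList π)))

avoiders : ∀ n → Enumeration (Fin (Bell n)) (λ (π : Vec (Fin n) n) → IsPerm π × Avoids pat12 π)
avoiders n = image oneLine oneLine-injective oneLine-avoider avoider-oneLine (partitionsUpTo n n)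

-- The count also holds for n = 0 (only the empty permutation, B₀ = 1).
theorem3p3 : (n : ℕ) → 1 ≤ n → HasExactlyAvoiders n pat12 (Bell n)
theorem3p3 n _ = enum E , (λ _ _ → injective E) , sound E , λ π π-perm avoid → complete E (π-perm , avoid)
  where E = avoiders n
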